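{- For all finite multisets $\Gamma,\Delta$ of formulas: $\Gamma\Rightarrow\Delta$ is derivable in $\mathsf{GWF_{N_2}}$ if and only if $\vdash_{\mathsf{WF_{N_2}}}\bigwedge\Gamma\rightarrow\bigvee\Delta$.
   Context: Formulas are built from a countable set of propositional atoms and $\bot$ using $\wedge,\vee,\rightarrow$; $A\leftrightarrow B$ abbreviates $(A\rightarrow B)\wedge(B\rightarrow A)$. $\bigwedge\Gamma$, $\bigvee\Delta$ are the conjunction/disjunction of the formulas of the multiset (empty conjunction read as $\bot\rightarrow\bot$, empty disjunction as $\bot$). Sequent calculus $\mathsf{GWF_{N_2}}$ (sequents $\Gamma\Rightarrow\Delta$, finite multisets, $p$ atomic): (Ax) $p,\Gamma\Rightarrow\Delta,p$; ($\bot_L$) $\bot,\Gamma\Rightarrow\Delta$; ($\wedge_L$) from $A,B,\Gamma\Rightarrow\Delta$ infer $A\wedge B,\Gamma\Rightarrow\Delta$; ($\wedge_R$) from $\Gamma\Rightarrow\Delta,A$ and $\Gamma\Rightarrow\Delta,B$ infer $\Gamma\Rightarrow\Delta,A\wedge B$; ($\vee_L$) from $A,\Gamma\Rightarrow\Delta$ and $B,\Gamma\Rightarrow\Delta$ infer $A\vee B,\Gamma\Rightarrow\Delta$; ($\vee_R$) from $\Gamma\Rightarrow\Delta,A,B$ infer $\Gamma\Rightarrow\Delta,A\vee B$; ($\rightarrow_R$) from $A\Rightarrow B$ infer $\Gamma\Rightarrow A\rightarrow B,\Delta$; ($\rightarrow_{LR_{N_2}}$) from $A\Rightarrow C,B$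 and $A,D\Rightarrow B$ infer $\Gamma,C\rightarrow D\Rightarrow A\rightarrow B,\Delta$. Hilbert system $\mathsf{WF}$: axioms all instances of $A\rightarrow(A\vee B)$; $B\rightarrow(A\vee B)$; $(A\wedge B)\rightarrow A$; $(A\wedge B)\rightarrow B$; $A\wedge(B\vee C)\rightarrow(A\wedge B)\vee(A\wedge C)$; $A\rightarrow A$; $\bot\rightarrow A$; rules: from $A$, $A\rightarrow B$ infer $B$; from $A$ infer $B\rightarrow A$; from $A\rightarrow B$, $B\rightarrow C$ infer $A\rightarrow C$; from $A\rightarrow B$, $A\rightarrow C$ infer $A\rightarrow(B\wedge C)$; from $A\rightarrow C$, $B\rightarrow C$ infer $(A\vee B)\rightarrow C$; from $A$, $B$ infer $A\wedge B$; from $A\leftrightarrow B$, $C\leftrightarrow D$ infer $(A\rightarrow C)\leftrightarrow(B\rightarrow D)$. $\mathsf{WF_{N_2}}$ is $\mathsf{WF}$ plus the rule ($\mathsf{N_2}$): from $C\rightarrow A\vee D$ and $C\wedge B\rightarrow D$ infer $(A\rightarrow B)\rightarrow(C\rightarrow D)$. $\vdash_{\mathsf{WF_{N_2}}}A$ means $A$ is a theorem of $\mathsf{WF_{N_2}}$. -}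

module Defs where

open import Data.Nat using (ℕ)
open import Data.List using (List; []; _∷_)
open import Data.List.Relation.Binary.Permutation.Propositional using (_↭_)

data Fm : Set where
  atom : ℕ → Fm
  ⊥'   : Fm
  _∧'_ : Fm → Fm → Fm
  _∨'_ : Fm → Fm → Fm
  _⇒'_ : Fm → Fm → Fm

infixr 6 _∧'_
infixr 5 _∨'_
infixr 4 _⇒'_

_⇔'_ : Fm → Fm → Fm
A ⇔' B = (A ⇒' B) ∧' (B ⇒' A)

⋀ : List Fm → Fm
⋀ []           = ⊥' ⇒' ⊥'
⋀ (A ∷ [])     = A
⋀ (A ∷ B ∷ Γ)  = A ∧' ⋀ (B ∷ Γ)

⋁ : List Fm → Fm
⋁ []           = ⊥'
⋁ (A ∷ [])     = A
⋁ (A ∷ B ∷ Δ)  = A ∨' ⋁ (B ∷ Δ)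

-- Multisets are represented by lists, together
-- with an explicit rule closing derivability under permutation of either
-- side (so derivability depends only on the underlying multisets).
-- Principal formulas are written at the head of the respective list.
infix 3 _⊢G_
data _⊢G_ : List Fm → List Fm → Set where
  perm : ∀ {Γ Γ' Δ Δ'} → Γ ↭ Γ' → Δ ↭ Δ' → Γ ⊢G Δ → Γ' ⊢G Δ'
  ax   : ∀ {p Γ Δ} → atom p ∷ Γ ⊢G atom p ∷ Δ
  ⊥L   : ∀ {Γ Δ} → ⊥' ∷ Γ ⊢G Δ
  ∧L   : ∀ {A B Γ Δ} → A ∷ B ∷ Γ ⊢G Δ → (A ∧' B) ∷ Γ ⊢G Δ
  ∧R   : ∀ {A B Γ Δ} → Γ ⊢G A ∷ Δ → Γ ⊢G B ∷ Δ → Γ ⊢G (A ∧' B) ∷ Δ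
  ∨L   : ∀ {A B Γ Δ} → A ∷ Γ ⊢G Δ → B ∷ Γ ⊢G Δ → (A ∨' B) ∷ Γ ⊢G Δ
  ∨R   : ∀ {A B Γ Δ} → Γ ⊢G A ∷ B ∷ Δ → Γ ⊢G (A ∨' B) ∷ Δ
  ⇒R   : ∀ {A B Γ Δ} → A ∷ [] ⊢G B ∷ [] → Γ ⊢G (A ⇒' B) ∷ Δ
  ⇒LR  : ∀ {A B C D Γ Δ} → A ∷ [] ⊢G C ∷ B ∷ [] → A ∷ D ∷ [] ⊢G B ∷ []
       → (C ⇒' D) ∷ Γ ⊢G (A ⇒' B) ∷ Δ

data ⊢WF : Fm → Set where
  ax∨₁  : ∀ {A B} → ⊢WF (A ⇒' A ∨' B)
  ax∨₂  : ∀ {A B} → ⊢WF (B ⇒' A ∨' B)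
  ax∧₁  : ∀ {A B} → ⊢WF (A ∧' B ⇒' A)
  ax∧₂  : ∀ {A B} → ⊢WF (A ∧' B ⇒' B)
  axD   : ∀ {A B C} → ⊢WF (A ∧' (B ∨' C) ⇒' (A ∧' B) ∨' (A ∧' C))
  axId  : ∀ {A} → ⊢WF (A ⇒' A)
  ax⊥   : ∀ {A} → ⊢WF (⊥' ⇒' A)
  mp    : ∀ {A B} → ⊢WF A → ⊢WF (A ⇒' B) → ⊢WF B
  wk    : ∀ {A B} → ⊢WF A → ⊢WF (B ⇒' A)
  tr    : ∀ {A B C} → ⊢WF (A ⇒' B) → ⊢WF (B ⇒' C) → ⊢WF (A ⇒' C)
  cj⇒   : ∀ {A B C} → ⊢WF (A ⇒' B) → ⊢WF (A ⇒' C) → ⊢WF (A ⇒' B ∧' C)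
  dj⇒   : ∀ {A B C} → ⊢WF (A ⇒' C) → ⊢WF (B ⇒' C) → ⊢WF (A ∨' B ⇒' C)
  cj    : ∀ {A B} → ⊢WF A → ⊢WF B → ⊢WF (A ∧' B)
  cong⇒ : ∀ {A B C D} → ⊢WF (A ⇔' B) → ⊢WF (C ⇔' D)
        → ⊢WF ((A ⇒' C) ⇔' (B ⇒' D))
  N2    : ∀ {A B C D} → ⊢WF (C ⇒' A ∨' D) → ⊢WF (C ∧' B ⇒' D)
        → ⊢WF ((A ⇒' B) ⇒' (C ⇒' D))

{-# OPTIONS --safe #-}
module Submission where

-- Soundness is a direct induction on derivations, using that ⋀ and ⋁ respect
-- permutations in WF_N2. For completeness every axiom and rule of WF_N2 is derived
-- in the calculus; modus ponens and transitivity need cut, which is admissible by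
-- induction on the cut formula. Conjunctions and disjunctions are cut by inverting
-- their rules, and ⊥ on the right is simply dropped. An atom or implication B ⇒ C
-- is traced up the left derivation to its principal occurrences: an axiom leads to a
-- contraction of atoms, ⇒R provides B ⊢ C, which lets B ⇒ C be dropped from the
-- antecedent of the right derivation, and ⇒LR from some E ⇒ F provides exactly what
-- is needed to let E ⇒ F take over every principal use of B ⇒ C there.

open import Data.List using (List; []; _∷_; _++_)
open import Data.List.Membership.Propositional using (_∈_)
open import Data.List.Relation.Binary.Permutation.Propositional
  using (_↭_; refl; prep; swap; trans; ↭-sym)
open import Data.List.Relation.Binary.Permutation.Propositional.Properties
  using (∈-resp-↭; drop-∷; shift; shifts; ++⁺ˡ; ++⁺ʳ; ++-identityʳ; ∷↭∷ʳ;
         ↭-empty-inv; ↭-singleton-inv)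
open import Data.List.Membership.Propositional.Properties using (∈-∃++)
open import Data.List.Relation.Unary.Any using (here; there)
open import Data.Nat using (ℕ)
open import Data.Product using (_×_; _,_; ∃-syntax)
open import Data.Unit using (⊤; tt)
open import Defs
open import Relation.Binary.PropositionalEquality using (_≡_; refl)

private variable
  p : ℕ
  A B C D E F G H X Z : Fm
  Γ Γ' Γ₀ Γ₁ Δ Δ' Δ₀ Δ₁ zs : List Fm

-- Soundness

infix 4 _≤_
_≤_ : Fm → Fm → Set
A ≤ B = ⊢WF (A ⇒' B)

open import Relation.Binary.Reasoning.Base.Single _≤_ axId tr

∧-mono : A ≤ B → C ≤ D → A ∧' C ≤ B ∧' D
∧-mono f g = cj⇒ (tr ax∧₁ f) (tr ax∧₂ g)

∨-mono : A ≤ B → C ≤ D → A ∨' C ≤ B ∨' D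
∨-mono f g = dj⇒ (tr f ax∨₁) (tr g ax∨₂)

∧-comm : A ∧' B ≤ B ∧' A
∧-comm = cj⇒ ax∧₂ ax∧₁

∧-assoc : (A ∧' B) ∧' C ≤ A ∧' B ∧' C
∧-assoc = cj⇒ (tr ax∧₁ ax∧₁) (∧-mono ax∧₂ axId)

∨-assoc : A ∨' B ∨' C ≤ (A ∨' B) ∨' C
∨-assoc = dj⇒ (tr ax∨₁ ax∨₁) (∨-mono ax∨₂ axId)

∧-exchange : A ∧' B ∧' C ≤ B ∧' A ∧' C
∧-exchange = cj⇒ (tr ax∧₂ ax∧₁) (∧-mono axId ax∧₂)

∨-exchange : A ∨' B ∨' C ≤ B ∨' A ∨' C
∨-exchange = dj⇒ (tr ax∨₁ ax∨₂) (∨-mono axId ax∨₂)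

∧-distribʳ-∨ : (A ∨' B) ∧' C ≤ (A ∧' C) ∨' (B ∧' C)
∧-distribʳ-∨ = tr ∧-comm (tr axD (∨-mono ∧-comm ∧-comm))

∨-distribʳ-∧ : (A ∨' C) ∧' (B ∨' C) ≤ (A ∧' B) ∨' C
∨-distribʳ-∧ = tr axD (dj⇒ (tr ∧-comm (tr axD (∨-mono ∧-comm ax∧₂))) (tr ax∧₂ ax∨₂))

⋀-uncons : ∀ A Γ → ⋀ (A ∷ Γ) ≤ A ∧' ⋀ Γ
⋀-uncons A []      = cj⇒ axId (wk ax⊥)
⋀-uncons A (_ ∷ _) = axId

⋀-cons : ∀ A Γ → A ∧' ⋀ Γ ≤ ⋀ (A ∷ Γ)
⋀-cons A []      = ax∧₁
⋀-cons A (_ ∷ _) = axId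

⋁-uncons : ∀ A Δ → ⋁ (A ∷ Δ) ≤ A ∨' ⋁ Δ
⋁-uncons A []      = ax∨₁
⋁-uncons A (_ ∷ _) = axId

⋁-cons : ∀ A Δ → A ∨' ⋁ Δ ≤ ⋁ (A ∷ Δ)
⋁-cons A []      = dj⇒ axId ax⊥
⋁-cons A (_ ∷ _) = axId

⋀-head : ∀ A Γ → ⋀ (A ∷ Γ) ≤ A
⋀-head A Γ = tr (⋀-uncons A Γ) ax∧₁

⋁-head : ∀ A Δ → A ≤ ⋁ (A ∷ Δ)
⋁-head A Δ = tr ax∨₁ (⋁-cons A Δ)

⋀-resp-↭ : Γ ↭ Γ' → ⋀ Γ ≤ ⋀ Γ'
⋀-resp-↭ refl = axId
⋀-resp-↭ (prep {xs} {ys} x ρ) = begin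
  ⋀ (x ∷ xs)     ∼⟨ ⋀-uncons x xs ⟩
  x ∧' ⋀ xs      ∼⟨ ∧-mono axId (⋀-resp-↭ ρ) ⟩
  x ∧' ⋀ ys      ∼⟨ ⋀-cons x ys ⟩
  ⋀ (x ∷ ys)     ∎
⋀-resp-↭ (swap {xs} {ys} x y ρ) = begin
  ⋀ (x ∷ y ∷ xs)      ∼⟨ ∧-mono axId (⋀-uncons y xs) ⟩
  x ∧' y ∧' ⋀ xs      ∼⟨ ∧-exchange ⟩
  y ∧' x ∧' ⋀ xs      ∼⟨ ∧-mono axId (tr (∧-mono axId (⋀-resp-↭ ρ)) (⋀-cons x ys)) ⟩
  ⋀ (y ∷ x ∷ ys)      ∎
⋀-resp-↭ (trans ρ σ) = tr (⋀-resp-↭ ρ) (⋀-resp-↭ σ)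

⋁-resp-↭ : Δ ↭ Δ' → ⋁ Δ ≤ ⋁ Δ'
⋁-resp-↭ refl = axId
⋁-resp-↭ (prep {xs} {ys} x ρ) = begin
  ⋁ (x ∷ xs)     ∼⟨ ⋁-uncons x xs ⟩
  x ∨' ⋁ xs      ∼⟨ ∨-mono axId (⋁-resp-↭ ρ) ⟩
  x ∨' ⋁ ys      ∼⟨ ⋁-cons x ys ⟩
  ⋁ (x ∷ ys)     ∎
⋁-resp-↭ (swap {xs} {ys} x y ρ) = begin
  ⋁ (x ∷ y ∷ xs)      ∼⟨ ∨-mono axId (⋁-uncons y xs) ⟩
  x ∨' y ∨' ⋁ xs      ∼⟨ ∨-exchange ⟩
  y ∨' x ∨' ⋁ xs      ∼⟨ ∨-mono axId (tr (∨-mono axId (⋁-resp-↭ ρ)) (⋁-cons x ys)) ⟩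
  ⋁ (y ∷ x ∷ ys)      ∎
⋁-resp-↭ (trans ρ σ) = tr (⋁-resp-↭ ρ) (⋁-resp-↭ σ)

sound : Γ ⊢G Δ → ⋀ Γ ≤ ⋁ Δ
sound (perm ρ σ d) = tr (⋀-resp-↭ (↭-sym ρ)) (tr (sound d) (⋁-resp-↭ σ))
sound (ax {p} {Γ} {Δ}) = tr (⋀-head _ Γ) (⋁-head _ Δ)
sound (⊥L {Γ})         = tr (⋀-head _ Γ) ax⊥
sound (∧L {A} {B} {Γ} {Δ} d) = begin
  ⋀ (A ∧' B ∷ Γ)      ∼⟨ ⋀-uncons _ Γ ⟩
  (A ∧' B) ∧' ⋀ Γ     ∼⟨ ∧-assoc ⟩
  A ∧' B ∧' ⋀ Γ       ∼⟨ ∧-mono axId (⋀-cons B Γ) ⟩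
  ⋀ (A ∷ B ∷ Γ)       ∼⟨ sound d ⟩
  ⋁ Δ                 ∎
sound (∧R {A} {B} {Γ} {Δ} d e) = begin
  ⋀ Γ                          ∼⟨ cj⇒ (tr (sound d) (⋁-uncons A Δ)) (tr (sound e) (⋁-uncons B Δ)) ⟩
  (A ∨' ⋁ Δ) ∧' (B ∨' ⋁ Δ)     ∼⟨ ∨-distribʳ-∧ ⟩
  (A ∧' B) ∨' ⋁ Δ              ∼⟨ ⋁-cons _ Δ ⟩
  ⋁ (A ∧' B ∷ Δ)               ∎
sound (∨L {A} {B} {Γ} {Δ} d e) = begin
  ⋀ ((A ∨' B) ∷ Γ)                  ∼⟨ ⋀-uncons _ Γ ⟩
  (A ∨' B) ∧' ⋀ Γ                 ∼⟨ ∧-distribʳ-∨ ⟩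
  (A ∧' ⋀ Γ) ∨' (B ∧' ⋀ Γ)        ∼⟨ dj⇒ (tr (⋀-cons A Γ) (sound d)) (tr (⋀-cons B Γ) (sound e)) ⟩
  ⋁ Δ                             ∎
sound (∨R {A} {B} {Γ} {Δ} d) = begin
  ⋀ Γ                 ∼⟨ sound d ⟩
  A ∨' ⋁ (B ∷ Δ)      ∼⟨ ∨-mono axId (⋁-uncons B Δ) ⟩
  A ∨' B ∨' ⋁ Δ       ∼⟨ ∨-assoc ⟩
  (A ∨' B) ∨' ⋁ Δ     ∼⟨ ⋁-cons _ Δ ⟩
  ⋁ ((A ∨' B) ∷ Δ)      ∎
sound (⇒R {Δ = Δ} d)         = tr (wk (sound d)) (⋁-head _ Δ)
sound (⇒LR {Γ = Γ} {Δ} d e)  = tr (⋀-head _ Γ) (tr (N2 (sound d) (sound e)) (⋁-head _ Δ))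

-- Structural rules

∈⇒↭ : X ∈ Γ → ∃[ zs ] Γ ↭ X ∷ zs
∈⇒↭ {X} m with ys , zs , refl ← ∈-∃++ m = ys ++ zs , shift X ys zs

weaken : ∀ Γ' Δ' → Γ ⊢G Δ → Γ ++ Γ' ⊢G Δ ++ Δ'
weaken Γ' Δ' (perm ρ σ d) = perm (++⁺ʳ Γ' ρ) (++⁺ʳ Δ' σ) (weaken Γ' Δ' d)
weaken Γ' Δ' ax           = ax
weaken Γ' Δ' ⊥L           = ⊥L
weaken Γ' Δ' (∧L d)       = ∧L (weaken Γ' Δ' d)
weaken Γ' Δ' (∧R d e)     = ∧R (weaken Γ' Δ' d) (weaken Γ' Δ' e)
weaken Γ' Δ' (∨L d e)     = ∨L (weaken Γ' Δ' d) (weaken Γ' Δ' e)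
weaken Γ' Δ' (∨R d)       = ∨R (weaken Γ' Δ' d)
weaken Γ' Δ' (⇒R d)       = ⇒R d
weaken Γ' Δ' (⇒LR d e)    = ⇒LR d e

weakenˡ : ∀ X → Γ ⊢G Δ → X ∷ Γ ⊢G Δ
weakenˡ {Γ} {Δ} X d = perm (↭-sym (∷↭∷ʳ X Γ)) (++-identityʳ Δ) (weaken (X ∷ []) [] d)

weakenʳ : ∀ X → Γ ⊢G Δ → Γ ⊢G X ∷ Δ
weakenʳ {Γ} {Δ} X d = perm (++-identityʳ Γ) (↭-sym (∷↭∷ʳ X Δ)) (weaken [] (X ∷ []) d)

exchangeˡ : A ∷ B ∷ Γ ⊢G Δ → B ∷ A ∷ Γ ⊢G Δ
exchangeˡ = perm (swap _ _ refl) refl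

exchangeʳ : Γ ⊢G A ∷ B ∷ Δ → Γ ⊢G B ∷ A ∷ Δ
exchangeʳ = perm refl (swap _ _ refl)

identity : ∀ A → A ∷ [] ⊢G A ∷ []
identity (atom p) = ax
identity ⊥'       = ⊥L
identity (A ∧' B) =
  ∧L (∧R (weaken (B ∷ []) [] (identity A)) (exchangeˡ (weaken (A ∷ []) [] (identity B))))
identity (A ∨' B) =
  ∨R (∨L (weaken [] (B ∷ []) (identity A)) (exchangeʳ (weaken [] (A ∷ []) (identity B))))
identity (A ⇒' B) =
  ⇒LR (weaken [] (B ∷ []) (identity A)) (exchangeˡ (weaken (A ∷ []) [] (identity B)))

axiom : A ∷ Γ ⊢G A ∷ Δ
axiom {A} {Γ} {Δ} = weaken Γ Δ (identity A)

axiom-∈ : atom p ∈ Γ → Γ ⊢G atom p ∷ Δ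
axiom-∈ m with _ , ρ ← ∈⇒↭ m = perm (↭-sym ρ) refl ax

-- Cut admissibility

data HeadCase (Z : Fm) (Γ₀ : List Fm) (X : Fm) (Γ : List Fm) : Set where
  same   : Z ≡ X → Γ₀ ↭ Γ → HeadCase Z Γ₀ X Γ
  differ : Γ ↭ Z ∷ zs → Γ₀ ↭ X ∷ zs → HeadCase Z Γ₀ X Γ

headCase : Z ∷ Γ₀ ↭ X ∷ Γ → HeadCase Z Γ₀ X Γ
headCase {Z} {X = X} r with ∈-resp-↭ r (here refl)
... | here refl = same refl (drop-∷ r)
... | there m with _ , ρ ← ∈⇒↭ m =
  differ ρ (drop-∷ (trans r (trans (prep X ρ) (swap X Z refl))))

pull : ∀ Zs → Γ₀ ↭ X ∷ zs → Zs ++ Γ₀ ↭ X ∷ Zs ++ zs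
pull {X = X} {zs} Zs ρ = trans (++⁺ˡ Zs ρ) (shift X Zs zs)

restore : ∀ Ys → Γ ↭ Z ∷ zs → Z ∷ Ys ++ zs ↭ Ys ++ Γ
restore {Z = Z} {zs} Ys ρ = trans (↭-sym (shift Z Ys zs)) (++⁺ˡ Ys (↭-sym ρ))

record InversionClosed (P : List Fm → List Fm → Set) : Set where
  field
    resp-↭ : Γ ↭ Γ' → Δ ↭ Δ' → P Γ Δ → P Γ' Δ'
    ∧L⁻    : P ((A ∧' B) ∷ Γ) Δ → P (A ∷ B ∷ Γ) Δ
    ∨L⁻₁   : P ((A ∨' B) ∷ Γ) Δ → P (A ∷ Γ) Δ
    ∨L⁻₂   : P ((A ∨' B) ∷ Γ) Δ → P (B ∷ Γ) Δ
    ∧R⁻₁   : P Γ ((A ∧' B) ∷ Δ) → P Γ (A ∷ Δ)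
    ∧R⁻₂   : P Γ ((A ∧' B) ∷ Δ) → P Γ (B ∷ Δ)
    ∨R⁻    : P Γ ((A ∨' B) ∷ Δ) → P Γ (A ∷ B ∷ Δ)

⊤-inversionClosed : InversionClosed (λ _ _ → ⊤)
⊤-inversionClosed = record
  { resp-↭ = λ _ _ _ → tt ; ∧L⁻ = λ _ → tt ; ∨L⁻₁ = λ _ → tt ; ∨L⁻₂ = λ _ → tt
  ; ∧R⁻₁ = λ _ → tt ; ∧R⁻₂ = λ _ → tt ; ∨R⁻ = λ _ → tt }

data Rigid : Fm → Set where
  atom : Rigid (atom p)
  _⇒_  : ∀ A B → Rigid (A ⇒' B)

∈-inversionClosed : Rigid X → InversionClosed (λ Γ _ → X ∈ Γ)
∈-inversionClosed x = record
  { resp-↭ = λ ρ _ → ∈-resp-↭ ρ ; ∧L⁻ = ∧L⁻ x ; ∨L⁻₁ = ∨L⁻ x ; ∨L⁻₂ = ∨L⁻ x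
  ; ∧R⁻₁ = λ m → m ; ∧R⁻₂ = λ m → m ; ∨R⁻ = λ m → m }
  where
  ∧L⁻ : Rigid X → X ∈ (A ∧' B) ∷ Γ → X ∈ A ∷ B ∷ Γ
  ∧L⁻ _  (there m)   = there (there m)
  ∧L⁻ () (here refl)
  ∨L⁻ : Rigid X → X ∈ (A ∨' B) ∷ Γ → X ∈ Z ∷ Γ
  ∨L⁻ _  (there m)   = there m
  ∨L⁻ () (here refl)

data PrincipalL : Fm → List Fm → List Fm → Set where
  ax  : PrincipalL (atom p) Γ (atom p ∷ Δ)
  ⊥L  : PrincipalL ⊥' Γ Δ
  ∧L  : A ∷ B ∷ Γ ⊢G Δ → PrincipalL (A ∧' B) Γ Δ
  ∨L  : A ∷ Γ ⊢G Δ → B ∷ Γ ⊢G Δ → PrincipalL (A ∨' B) Γ Δ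
  ⇒LR : A ∷ [] ⊢G C ∷ B ∷ [] → A ∷ D ∷ [] ⊢G B ∷ [] → PrincipalL (C ⇒' D) Γ ((A ⇒' B) ∷ Δ)

data PrincipalR : Fm → List Fm → List Fm → Set where
  ax  : PrincipalR (atom p) (atom p ∷ Γ) Δ
  ∧R  : Γ ⊢G A ∷ Δ → Γ ⊢G B ∷ Δ → PrincipalR (A ∧' B) Γ Δ
  ∨R  : Γ ⊢G A ∷ B ∷ Δ → PrincipalR (A ∨' B) Γ Δ
  ⇒R  : A ∷ [] ⊢G B ∷ [] → PrincipalR (A ⇒' B) Γ Δ
  ⇒LR : A ∷ [] ⊢G C ∷ B ∷ [] → A ∷ D ∷ [] ⊢G B ∷ [] → PrincipalR (A ⇒' B) ((C ⇒' D) ∷ Γ) Δ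

-- An occurrence of X can be replaced by Ys as soon as this can be done where X is
-- principal: all other rules commute with the replacement, and P carries side
-- information about the rest of the sequent up to the premises.
module _ {P : List Fm → List Fm → Set} (closed : InversionClosed P) {X : Fm} {Ys : List Fm}
         (principal : ∀ {Γ Δ} → P Γ Δ → PrincipalL X Γ Δ → Ys ++ Γ ⊢G Δ) where
  open InversionClosed closed

  replaceL : Γ₁ ⊢G Δ → Γ₁ ↭ X ∷ Γ → P Γ Δ → Ys ++ Γ ⊢G Δ
  replaceL-under : ∀ Zs → Zs ++ Γ₀ ⊢G Δ → Γ₀ ↭ X ∷ zs → P (Zs ++ zs) Δ → Zs ++ Ys ++ zs ⊢G Δ

  replaceL-under Zs d ρ s = perm (shifts Ys Zs) refl (replaceL d (pull Zs ρ) s)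

  replaceL (perm ρ σ d) r s = perm refl σ (replaceL d (trans ρ r) (resp-↭ refl (↭-sym σ) s))
  replaceL ax r s with headCase r
  ... | same refl _ = principal s ax
  ... | differ ρ _  = perm (restore Ys ρ) refl ax
  replaceL ⊥L r s with headCase r
  ... | same refl _ = principal s ⊥L
  ... | differ ρ _  = perm (restore Ys ρ) refl ⊥L
  replaceL (∧L {A} {B} d) r s with headCase r
  ... | same refl ρ  = principal s (∧L (perm (prep A (prep B ρ)) refl d))
  ... | differ ρ ρ₀ = perm (restore Ys ρ) refl
                        (∧L (replaceL-under (A ∷ B ∷ []) d ρ₀ (∧L⁻ (resp-↭ ρ refl s))))
  replaceL (∨L {A} {B} d e) r s with headCase r
  ... | same refl ρ  = principal s (∨L (perm (prep A ρ) refl d) (perm (prep B ρ) refl e))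
  ... | differ ρ ρ₀ = perm (restore Ys ρ) refl
                        (∨L (replaceL-under (A ∷ []) d ρ₀ (∨L⁻₁ (resp-↭ ρ refl s)))
                            (replaceL-under (B ∷ []) e ρ₀ (∨L⁻₂ (resp-↭ ρ refl s))))
  replaceL (⇒LR d e) r s with headCase r
  ... | same refl _ = principal s (⇒LR d e)
  ... | differ ρ _  = perm (restore Ys ρ) refl (⇒LR d e)
  replaceL (∧R d e) r s = ∧R (replaceL d r (∧R⁻₁ s)) (replaceL e r (∧R⁻₂ s))
  replaceL (∨R d) r s   = ∨R (replaceL d r (∨R⁻ s))
  replaceL (⇒R d) r s   = ⇒R d

module _ {P : List Fm → List Fm → Set} (closed : InversionClosed P) {X : Fm} {Ys : List Fm}
         (principal : ∀ {Γ Δ} → P Γ Δ → PrincipalR X Γ Δ → Γ ⊢G Ys ++ Δ) where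
  open InversionClosed closed

  replaceR : Γ ⊢G Δ₁ → Δ₁ ↭ X ∷ Δ → P Γ Δ → Γ ⊢G Ys ++ Δ
  replaceR-under : ∀ Zs → Γ ⊢G Zs ++ Δ₀ → Δ₀ ↭ X ∷ zs → P Γ (Zs ++ zs) → Γ ⊢G Zs ++ Ys ++ zs

  replaceR-under Zs d ρ s = perm refl (shifts Ys Zs) (replaceR d (pull Zs ρ) s)

  replaceR (perm ρ σ d) r s = perm ρ refl (replaceR d (trans σ r) (resp-↭ (↭-sym ρ) refl s))
  replaceR ax r s with headCase r
  ... | same refl _ = principal s ax
  ... | differ ρ _  = perm refl (restore Ys ρ) ax
  replaceR ⊥L r s       = ⊥L
  replaceR (∧L d) r s   = ∧L (replaceR d r (∧L⁻ s))
  replaceR (∨L d e) r s = ∨L (replaceR d r (∨L⁻₁ s)) (replaceR e r (∨L⁻₂ s))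
  replaceR (∧R {A} {B} d e) r s with headCase r
  ... | same refl ρ  = principal s (∧R (perm refl (prep A ρ) d) (perm refl (prep B ρ) e))
  ... | differ ρ ρ₀ = perm refl (restore Ys ρ)
                        (∧R (replaceR-under (A ∷ []) d ρ₀ (∧R⁻₁ (resp-↭ refl ρ s)))
                            (replaceR-under (B ∷ []) e ρ₀ (∧R⁻₂ (resp-↭ refl ρ s))))
  replaceR (∨R {A} {B} d) r s with headCase r
  ... | same refl ρ  = principal s (∨R (perm refl (prep A (prep B ρ)) d))
  ... | differ ρ ρ₀ = perm refl (restore Ys ρ)
                        (∨R (replaceR-under (A ∷ B ∷ []) d ρ₀ (∨R⁻ (resp-↭ refl ρ s))))
  replaceR (⇒R d) r s with headCase r
  ... | same refl _ = principal s (⇒R d)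
  ... | differ ρ _  = perm refl (restore Ys ρ) (⇒R d)
  replaceR (⇒LR d e) r s with headCase r
  ... | same refl _ = principal s (⇒LR d e)
  ... | differ ρ _  = perm refl (restore Ys ρ) (⇒LR d e)

∧L-inv : Γ₁ ⊢G Δ → Γ₁ ↭ (A ∧' B) ∷ Γ → A ∷ B ∷ Γ ⊢G Δ
∧L-inv d r = replaceL ⊤-inversionClosed principal d r tt
  where
  principal : ⊤ → PrincipalL (A ∧' B) Γ Δ → A ∷ B ∷ Γ ⊢G Δ
  principal _ (∧L d) = d

∨L-inv₁ : Γ₁ ⊢G Δ → Γ₁ ↭ (A ∨' B) ∷ Γ → A ∷ Γ ⊢G Δ
∨L-inv₁ d r = replaceL ⊤-inversionClosed principal d r tt
  where
  principal : ⊤ → PrincipalL (A ∨' B) Γ Δ → A ∷ Γ ⊢G Δ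
  principal _ (∨L d _) = d

∨L-inv₂ : Γ₁ ⊢G Δ → Γ₁ ↭ (A ∨' B) ∷ Γ → B ∷ Γ ⊢G Δ
∨L-inv₂ d r = replaceL ⊤-inversionClosed principal d r tt
  where
  principal : ⊤ → PrincipalL (A ∨' B) Γ Δ → B ∷ Γ ⊢G Δ
  principal _ (∨L _ e) = e

∧R-inv₁ : Γ ⊢G Δ₁ → Δ₁ ↭ (A ∧' B) ∷ Δ → Γ ⊢G A ∷ Δ
∧R-inv₁ d r = replaceR ⊤-inversionClosed principal d r tt
  where
  principal : ⊤ → PrincipalR (A ∧' B) Γ Δ → Γ ⊢G A ∷ Δ
  principal _ (∧R d _) = d

∧R-inv₂ : Γ ⊢G Δ₁ → Δ₁ ↭ (A ∧' B) ∷ Δ → Γ ⊢G B ∷ Δ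
∧R-inv₂ d r = replaceR ⊤-inversionClosed principal d r tt
  where
  principal : ⊤ → PrincipalR (A ∧' B) Γ Δ → Γ ⊢G B ∷ Δ
  principal _ (∧R _ e) = e

∨R-inv : Γ ⊢G Δ₁ → Δ₁ ↭ (A ∨' B) ∷ Δ → Γ ⊢G A ∷ B ∷ Δ
∨R-inv d r = replaceR ⊤-inversionClosed principal d r tt
  where
  principal : ⊤ → PrincipalR (A ∨' B) Γ Δ → Γ ⊢G A ∷ B ∷ Δ
  principal _ (∨R d) = d

⊥R-drop : Γ ⊢G ⊥' ∷ Δ → Γ ⊢G Δ
⊥R-drop d = replaceR ⊤-inversionClosed (λ _ ()) d refl tt

contract-atomˡ : atom p ∷ atom p ∷ Γ ⊢G Δ → atom p ∷ Γ ⊢G Δ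
contract-atomˡ d = replaceL (∈-inversionClosed atom) principal d refl (here refl)
  where
  principal : atom p ∈ Γ → PrincipalL (atom p) Γ Δ → Γ ⊢G Δ
  principal m ax = axiom-∈ m

⊢-inversionClosed : InversionClosed (λ Γ Δ → X ∷ Γ ⊢G Δ)
⊢-inversionClosed {X} = record
  { resp-↭ = λ ρ σ → perm (prep X ρ) σ
  ; ∧L⁻    = λ {A} {B} {Γ} d → perm (shift X (A ∷ B ∷ []) Γ) refl (∧L-inv d (swap X _ refl))
  ; ∨L⁻₁   = λ d → exchangeˡ (∨L-inv₁ d (swap X _ refl))
  ; ∨L⁻₂   = λ d → exchangeˡ (∨L-inv₂ d (swap X _ refl))
  ; ∧R⁻₁   = λ d → ∧R-inv₁ d refl
  ; ∧R⁻₂   = λ d → ∧R-inv₂ d refl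
  ; ∨R⁻    = λ d → ∨R-inv d refl }

CutFor : Fm → Set
CutFor A = ∀ {Γ Δ} → Γ ⊢G A ∷ Δ → A ∷ Γ ⊢G Δ → Γ ⊢G Δ

cut-atom : CutFor (atom p)
cut-atom d e = replaceR ⊢-inversionClosed principal d refl e
  where
  principal : atom p ∷ Γ ⊢G Δ → PrincipalR (atom p) Γ Δ → Γ ⊢G Δ
  principal e ax = contract-atomˡ e

module _ {B C : Fm} (cut-B : CutFor B) (cut-C : CutFor C) where

  ⇒LR-premises-cut : G ∷ [] ⊢G B ∷ H ∷ [] → G ∷ C ∷ [] ⊢G H ∷ [] →
                     B ∷ Γ ⊢G C ∷ Δ → G ∷ Γ ⊢G H ∷ Δ
  ⇒LR-premises-cut {G} {H} {Γ} {Δ} gbh gch bc = cut-B (weaken Γ Δ gbh) (cut-C bgch cbgh)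
    where
    bgch : B ∷ G ∷ Γ ⊢G C ∷ H ∷ Δ
    bgch = exchangeʳ (weakenʳ H (exchangeˡ (weakenˡ G bc)))
    cbgh : C ∷ B ∷ G ∷ Γ ⊢G H ∷ Δ
    cbgh = perm (↭-sym (shift G (C ∷ B ∷ []) Γ)) refl (weaken (B ∷ Γ) Δ gch)

  ⇒L-drop-valid : B ∷ [] ⊢G C ∷ [] → Γ₁ ⊢G Δ → Γ₁ ↭ (B ⇒' C) ∷ Γ → Γ ⊢G Δ
  ⇒L-drop-valid bc d r = replaceL ⊤-inversionClosed principal d r tt
    where
    principal : ⊤ → PrincipalL (B ⇒' C) Γ Δ → Γ ⊢G Δ
    principal _ (⇒LR gbh gch) = ⇒R (⇒LR-premises-cut gbh gch bc)

  -- bec and bfc are the premises of ⇒LR deriving E ⇒' F ⊢ B ⇒' C.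
  ⇒L-drop-entailed : B ∷ [] ⊢G E ∷ C ∷ [] → B ∷ F ∷ [] ⊢G C ∷ [] →
                     Γ₁ ⊢G Δ → Γ₁ ↭ (B ⇒' C) ∷ Γ → (E ⇒' F) ∈ Γ → Γ ⊢G Δ
  ⇒L-drop-entailed {E} {F} bec bfc d r m = replaceL (∈-inversionClosed (E ⇒ F)) principal d r m
    where
    principal : (E ⇒' F) ∈ Γ → PrincipalL (B ⇒' C) Γ Δ → Γ ⊢G Δ
    principal m (⇒LR gbh gch) with _ , ρ ← ∈⇒↭ m =
      perm (↭-sym ρ) refl (⇒LR (exchangeʳ (⇒LR-premises-cut gbh gch (exchangeʳ bec)))
                               (⇒LR-premises-cut gbh gch bfc))

  cut-⇒ : CutFor (B ⇒' C)
  cut-⇒ d e = replaceR ⊢-inversionClosed principal d refl e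
    where
    principal : (B ⇒' C) ∷ Γ ⊢G Δ → PrincipalR (B ⇒' C) Γ Δ → Γ ⊢G Δ
    principal e (⇒R bc)       = ⇒L-drop-valid bc e refl
    principal e (⇒LR bec bfc) = ⇒L-drop-entailed bec bfc e refl (here refl)

cut : ∀ A → CutFor A
cut (atom p)     = cut-atom
cut ⊥'       d e = ⊥R-drop d
cut (B ∧' C) d e =
  cut B (∧R-inv₁ d refl) (cut C (weakenˡ B (∧R-inv₂ d refl)) (exchangeˡ (∧L-inv e refl)))
cut (B ∨' C) d e =
  cut B (cut C (exchangeʳ (∨R-inv d refl)) (weakenʳ B (∨L-inv₂ e refl))) (∨L-inv₁ e refl)
cut (B ⇒' C)     = cut-⇒ (cut B) (cut C)

-- Completeness

⇒R-inv : [] ⊢G (A ⇒' B) ∷ [] → A ∷ [] ⊢G B ∷ []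
⇒R-inv d = go d refl
  where
  go : [] ⊢G Δ₁ → Δ₁ ↭ (A ⇒' B) ∷ [] → A ∷ [] ⊢G B ∷ []
  go (perm ρ σ d) r with refl ← ↭-empty-inv ρ = go d (trans σ r)
  go (∧R _ _)     r with () ← ↭-singleton-inv r
  go (∨R _)       r with () ← ↭-singleton-inv r
  go (⇒R d)       r with refl ← ↭-singleton-inv r = d

derivable : ⊢WF A → [] ⊢G A ∷ []
derivable⇒ : ⊢WF (A ⇒' B) → A ∷ [] ⊢G B ∷ []

derivable⇒ h = ⇒R-inv (derivable h)

derivable ax∨₁  = ⇒R (∨R axiom)
derivable ax∨₂  = ⇒R (∨R (exchangeʳ axiom))
derivable ax∧₁  = ⇒R (∧L axiom)
derivable ax∧₂  = ⇒R (∧L (exchangeˡ axiom))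
derivable axD   = ⇒R (∧L (exchangeˡ (∨L (∨R (∧R (exchangeˡ axiom) axiom))
                                        (∨R (exchangeʳ (∧R (exchangeˡ axiom) axiom))))))
derivable axId  = ⇒R (identity _)
derivable ax⊥   = ⇒R ⊥L
derivable (mp {A} {B} h₁ h₂) = cut A (weaken [] (B ∷ []) (derivable h₁)) (derivable⇒ h₂)
derivable (wk {B = B} h) = ⇒R (weaken (B ∷ []) [] (derivable h))
derivable (tr {A} {B} {C} h₁ h₂) =
  ⇒R (cut B (weaken [] (C ∷ []) (derivable⇒ h₁)) (weaken (A ∷ []) [] (derivable⇒ h₂)))
derivable (cj⇒ h₁ h₂) = ⇒R (∧R (derivable⇒ h₁) (derivable⇒ h₂))
derivable (dj⇒ h₁ h₂) = ⇒R (∨L (derivable⇒ h₁) (derivable⇒ h₂))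
derivable (cj h₁ h₂)  = ∧R (derivable h₁) (derivable h₂)
derivable (cong⇒ {A} {B} {C} {D} h₁ h₂) =
  ∧R (⇒R (⇒LR (weaken [] (D ∷ []) (backward h₁)) (exchangeˡ (weaken (B ∷ []) [] (forward h₂)))))
     (⇒R (⇒LR (weaken [] (C ∷ []) (forward h₁)) (exchangeˡ (weaken (A ∷ []) [] (backward h₂)))))
  where
  forward : ⊢WF (X ⇔' Z) → X ∷ [] ⊢G Z ∷ []
  forward h = ⇒R-inv (∧R-inv₁ (derivable h) refl)
  backward : ⊢WF (X ⇔' Z) → Z ∷ [] ⊢G X ∷ []
  backward h = ⇒R-inv (∧R-inv₂ (derivable h) refl)
derivable (N2 h₁ h₂) = ⇒R (⇒LR (∨R-inv (derivable⇒ h₁) refl) (∧L-inv (derivable⇒ h₂) refl))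

⋀-right : ∀ Γ → Γ ⊢G ⋀ Γ ∷ Δ
⋀-right []          = ⇒R ⊥L
⋀-right (A ∷ [])    = axiom
⋀-right (A ∷ B ∷ Γ) = ∧R axiom (weakenˡ A (⋀-right (B ∷ Γ)))

⋁-left : ∀ Δ → ⋁ Δ ∷ Γ ⊢G Δ
⋁-left []          = ⊥L
⋁-left (A ∷ [])    = axiom
⋁-left (A ∷ B ∷ Δ) = ∨L axiom (weakenʳ A (⋁-left (B ∷ Δ)))

complete : ⊢WF (⋀ Γ ⇒' ⋁ Δ) → Γ ⊢G Δ
complete {Γ} {Δ} h = cut (⋀ Γ) (⋀-right Γ) (cut (⋁ Δ) (weaken Γ Δ (derivable⇒ h)) (⋁-left Δ))

mainTheorem8 : (Γ Δ : List Fm) → ((Γ ⊢G Δ → ⊢WF (⋀ Γ ⇒' ⋁ Δ)) × (⊢WF (⋀ Γ ⇒' ⋁ Δ) → Γ ⊢G Δ))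
mainTheorem8 Γ Δ = sound , complete
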